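{- For every $k\in\mathbb{N}$ there exists a set $A_k\subset\mathbb{N}$ such that $\{1,\dots,k-1\}\subset A_k$, $k\notin A_k$, and both $\mathbb{N}\setminus A_k$ and $\Pr(A_k)$ are finite.
   Context: For $m\in\mathbb{N}$, $D(m)$ is the set of positive divisors of $m$. For $A\subset\mathbb{N}$, $S_A=\sum_{a\in A}a$ ($S_\emptyset=0$), and $A$ is a practical set if every non-negative integer $k\le S_A$ is a sum of distinct elements of $A$. A number $m\in\mathbb{N}$ is $A$-practical if $D(m)\cap A$ is a practical set, and $\Pr(A)$ is the set of all $A$-practical numbers. -}

module Defs where

open import Data.Nat using (ℕ; suc; _≤_; _<_)
open import Data.Nat.Divisibility using (_∣?_)
open import Data.Bool using (Bool; true; false; _∧_)
open import Data.List using (List; map; upTo; filterᵇ)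
open import Data.Nat.ListAction using (sum)
open import Data.List.Relation.Binary.Sublist.Propositional using (_⊆_)
open import Data.Product using (Σ; ∃; _×_)
open import Relation.Binary.PropositionalEquality using (_≡_)
open import Relation.Nullary.Decidable using (isYes)

-- A subset A of ℕ = {1,2,...} is represented by its (decidable) characteristic
-- function ℕ → Bool; the value at 0 is irrelevant (0 is never inspected).
Subset : Set
Subset = ℕ → Bool

oneTo : ℕ → List ℕ
oneTo m = map suc (upTo m)

divisorsIn : Subset → ℕ → List ℕ
divisorsIn A m = filterᵇ (λ d → A d ∧ isYes (d ∣? m)) (oneTo m)

-- k is a sum of distinct elements of the finite set listed (without
-- duplicates) by xs: a sum of a sub-list of xs.
SumOfDistinct : List ℕ → ℕ → Set
SumOfDistinct xs k = Σ (List ℕ) λ ys → ys ⊆ xs × sum ys ≡ k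

Practical : List ℕ → Set
Practical xs = (k : ℕ) → k ≤ sum xs → SumOfDistinct xs k

APractical : Subset → ℕ → Set
APractical A m = 1 ≤ m × Practical (divisorsIn A m)

CoFinite : Subset → Set
CoFinite A = ∃ λ N → (n : ℕ) → N ≤ n → A n ≡ true

PrFinite : Subset → Set
PrFinite A = ∃ λ N → (m : ℕ) → APractical A m → m < N

-- For k ≥ 1 let T = 1 + 2 + ⋯ + k and A = {1, …, k − 1} ∪ [T + 2, ∞), which misses k and is
-- cofinite. For m ≥ T + 2 the set D(m) ∩ A contains m, and its elements below k sum to
-- some s ≤ T. A sum of distinct elements of D(m) ∩ A either avoids the elements ≥ T + 2,
-- and then is at most s, or uses one of them, and then is at least T + 2; so s + 1 ≤ m is
-- not such a sum, and m is not A-practical. Hence Pr(A) ⊆ {1, …, T + 1}.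
module Submission where

open import Defs
open import Data.Nat using (ℕ; suc; _+_; _≤_; _<_; _≤′_; ≤′-refl; ≤′-step; z≤n; s≤s)
open import Data.Nat.Properties
open import Data.Nat.Divisibility using (_∣?_; ∣-refl)
open import Data.Nat.ListAction using (sum)
open import Data.Bool using (Bool; true; false; T; _∧_)
open import Data.Bool.Properties using (T-∧; T-≡; T-not-≡; T?)
open import Data.List using (List; []; _∷_; _++_; [_]; map; upTo; filter)
open import Data.List.Properties using (upTo-∷ʳ; map-++; filter-++; filter-accept; filter-reject; ++-identityʳ)
open import Data.List.Membership.Propositional using (_∈_)
open import Data.List.Membership.Propositional.Properties using (∈-map⁺; ∈-upTo⁺; ∈-filter⁺)
open import Data.List.Relation.Unary.All as All using (All; []; _∷_)
open import Data.List.Relation.Unary.All.Properties using (all-filter)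
open import Data.List.Relation.Unary.Any using (here; there)
open import Data.List.Relation.Binary.Sublist.Propositional using (_⊆_; []; _∷_; _∷ʳ_; ⊆-refl; ⊆-trans)
open import Data.List.Relation.Binary.Sublist.Propositional.Properties
  using (++⁺ʳ; filter-⊆; filter⁺; All-resp-⊆)
open import Data.Product using (Σ; _×_; _,_; proj₁)
open import Data.Sum using (_⊎_; inj₁; inj₂)
open import Function using (_∘_; Equivalence)
open import Relation.Binary.PropositionalEquality using (_≡_; refl; cong; sym; subst; module ≡-Reasoning)
open import Relation.Nullary using (¬_; Dec)
open import Relation.Nullary.Decidable using (isYes; _⊎-dec_; toWitness; fromWitness; fromWitnessFalse)

open ≡-Reasoning

sum-mono-⊆ : {xs ys : List ℕ} → xs ⊆ ys → sum xs ≤ sum ys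
sum-mono-⊆ []             = z≤n
sum-mono-⊆ (y ∷ʳ xs⊆ys)   = ≤-trans (sum-mono-⊆ xs⊆ys) (m≤n+m _ y)
sum-mono-⊆ (refl ∷ xs⊆ys) = +-monoʳ-≤ _ (sum-mono-⊆ xs⊆ys)

∈⇒≤sum : {n : ℕ} {ns : List ℕ} → n ∈ ns → n ≤ sum ns
∈⇒≤sum (here refl)  = m≤m+n _ _
∈⇒≤sum (there n∈ns) = ≤-trans (∈⇒≤sum n∈ns) (m≤n+m _ _)

oneTo-suc : ∀ m → oneTo (suc m) ≡ oneTo m ++ [ suc m ]
oneTo-suc m = begin
  map suc (upTo (suc m))       ≡⟨ cong (map suc) (upTo-∷ʳ m) ⟨
  map suc (upTo m ++ [ m ])    ≡⟨ map-++ suc (upTo m) [ m ] ⟩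
  oneTo m ++ [ suc m ]         ∎

suc-∈-oneTo : ∀ m → suc m ∈ oneTo (suc m)
suc-∈-oneTo m = ∈-map⁺ suc (∈-upTo⁺ ≤-refl)

oneTo-mono-⊆ : {m n : ℕ} → m ≤′ n → oneTo m ⊆ oneTo n
oneTo-mono-⊆ ≤′-refl = ⊆-refl
oneTo-mono-⊆ {m} (≤′-step {n} m≤′n) =
  subst (oneTo m ⊆_) (sym (oneTo-suc n)) (++⁺ʳ [ suc n ] (oneTo-mono-⊆ m≤′n))

module _ (k : ℕ) where

  small : List ℕ → List ℕ
  small = filter (_<? k)

  small-oneTo-stable : {m : ℕ} → k ≤′ m → small (oneTo m) ≡ small (oneTo k)
  small-oneTo-stable ≤′-refl = refl
  small-oneTo-stable (≤′-step {m} k≤′m) = begin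
    small (oneTo (suc m))                 ≡⟨ cong small (oneTo-suc m) ⟩
    small (oneTo m ++ [ suc m ])          ≡⟨ filter-++ (_<? k) (oneTo m) [ suc m ] ⟩
    small (oneTo m) ++ small [ suc m ]    ≡⟨ cong (small (oneTo m) ++_) (filter-reject (_<? k) k≮1+m) ⟩
    small (oneTo m) ++ []                 ≡⟨ ++-identityʳ _ ⟩
    small (oneTo m)                       ≡⟨ small-oneTo-stable k≤′m ⟩
    small (oneTo k)                       ∎
    where
    k≮1+m : ¬ suc m < k
    k≮1+m = ≤⇒≯ (m≤n⇒m≤1+n (≤′⇒≤ k≤′m))

  small-mono-⊆ : {xs ys : List ℕ} → xs ⊆ ys → small xs ⊆ small ys
  small-mono-⊆ = filter⁺ (_<? k) (_<? k) (λ { refl x<k → x<k })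

  small-oneTo-⊆ : ∀ m → small (oneTo m) ⊆ oneTo k
  small-oneTo-⊆ m = ⊆-trans
    (small-mono-⊆ (oneTo-mono-⊆ (≤⇒≤′ (m≤m⊔n m k))))
    (subst (_⊆ oneTo k) (sym (small-oneTo-stable (≤⇒≤′ (m≤n⊔m m k)))) (filter-⊆ (_<? k) (oneTo k)))

  module _ (B : ℕ) where

    SmallOrLarge : ℕ → Set
    SmallOrLarge x = x < k ⊎ B ≤ x

    sum-small⊎large : {ys : List ℕ} → All SmallOrLarge ys → sum ys ≡ sum (small ys) ⊎ B ≤ sum ys
    sum-small⊎large [] = inj₁ refl
    sum-small⊎large {y ∷ ys} (inj₂ B≤y ∷ _) = inj₂ (≤-trans B≤y (m≤m+n y _))
    sum-small⊎large {y ∷ ys} (inj₁ y<k ∷ ps) rewrite filter-accept (_<? k) {y} {ys} y<k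
      with sum-small⊎large ps
    ... | inj₁ sum≡ = inj₁ (cong (y +_) sum≡)
    ... | inj₂ B≤sum = inj₂ (≤-trans B≤sum (m≤n+m _ y))

    ¬SumOfDistinct-inGap : {xs : List ℕ} {s : ℕ} → All SmallOrLarge xs →
                           sum (small xs) < s → s < B → ¬ SumOfDistinct xs s
    ¬SumOfDistinct-inGap all-xs small<s s<B (ys , ys⊆xs , refl)
      with sum-small⊎large (All-resp-⊆ ys⊆xs all-xs)
    ... | inj₁ sum≡ = <⇒≱ small<s (≤-trans (≤-reflexive sum≡) (sum-mono-⊆ (small-mono-⊆ ys⊆xs)))
    ... | inj₂ B≤sum = <⇒≱ s<B B≤sum

self-∈-divisorsIn : (A : Subset) {m : ℕ} → 1 ≤ m → T (A m) → m ∈ divisorsIn A m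
self-∈-divisorsIn A {suc j} _ m∈A =
  ∈-filter⁺ (T? ∘ λ d → A d ∧ isYes (d ∣? suc j)) (suc-∈-oneTo j)
    (Equivalence.from T-∧ (m∈A , fromWitness ∣-refl))

gapEnd : ℕ → ℕ
gapEnd k = 2 + sum (oneTo k)

smallOrLarge? : ∀ k x → Dec (SmallOrLarge k (gapEnd k) x)
smallOrLarge? k x = x <? k ⊎-dec gapEnd k ≤? x

A : ℕ → Subset
A k n = isYes (smallOrLarge? k n)

¬SmallOrLarge-self : ∀ {k} → 1 ≤ k → ¬ SmallOrLarge k (gapEnd k) k
¬SmallOrLarge-self _       (inj₁ k<k) = <-irrefl refl k<k
¬SmallOrLarge-self {suc j} _ (inj₂ B≤k) = <⇒≱ k<B B≤k
  where
  k<B : suc j < gapEnd (suc j)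
  k<B = s≤s (m≤n⇒m≤1+n (∈⇒≤sum (suc-∈-oneTo j)))

divisorsIn-smallOrLarge : ∀ k m → All (SmallOrLarge k (gapEnd k)) (divisorsIn (A k) m)
divisorsIn-smallOrLarge k m =
  All.map (λ {d} d∈ → toWitness {a? = smallOrLarge? k d} (proj₁ (Equivalence.to T-∧ d∈)))
    (all-filter (T? ∘ p) (oneTo m))
  where
  p : ℕ → Bool
  p d = A k d ∧ isYes (d ∣? m)

¬APractical-beyondGap : ∀ k {m} → gapEnd k ≤ m → ¬ APractical (A k) m
¬APractical-beyondGap k {m} B≤m (1≤m , practical) =
  ¬SumOfDistinct-inGap k (gapEnd k) (divisorsIn-smallOrLarge k m) ≤-refl s<B (practical s s≤sum)
  where
  D = divisorsIn (A k) m
  s = suc (sum (small k D))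
  small≤ : sum (small k D) ≤ sum (oneTo k)
  small≤ = sum-mono-⊆ (⊆-trans (small-mono-⊆ k (filter-⊆ _ (oneTo m))) (small-oneTo-⊆ k m))
  s<B : s < gapEnd k
  s<B = s≤s (s≤s small≤)
  s≤sum : s ≤ sum D
  s≤sum = ≤-trans (<⇒≤ s<B) (≤-trans B≤m (∈⇒≤sum (self-∈-divisorsIn (A k) 1≤m (fromWitness (inj₂ B≤m)))))

theorem4p4 : (k : ℕ) → 1 ≤ k →
    Σ Subset λ A →
      ((i : ℕ) → 1 ≤ i → i < k → A i ≡ true) × A k ≡ false × CoFinite A × PrFinite A
theorem4p4 k 1≤k =
  A k
  , (λ i _ i<k → Equivalence.to T-≡ (fromWitness (inj₁ i<k)))
  , Equivalence.to T-not-≡ (fromWitnessFalse (¬SmallOrLarge-self 1≤k))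
  , (gapEnd k , λ n B≤n → Equivalence.to T-≡ (fromWitness (inj₂ B≤n)))
  , (gapEnd k , λ m m-practical → ≰⇒> (λ B≤m → ¬APractical-beyondGap k B≤m m-practical))
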